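{- Let $A$ and $B$ be two asynchronously composable IOTSes. (1) If $A$ and $B$ are I/O-separated and strongly synchronously compatible, then the asynchronous system $A\otimes_{as}B$ is half-duplex, and equivalently, for each $(s_A,s_B)\in\mathit{reach}(A\otimes B)$ and all transitions $s_A\xrightarrow{a}_A s_A'$, $s_B\xrightarrow{b}_B s_B'$, either $a\notin\mathit{out}_A\cap\mathit{in}_B$ or $b\notin\mathit{out}_B\cap\mathit{in}_A$. (2) If $A$ and $B$ are observationally I/O-separated and weakly synchronously compatible, then the same conclusions hold.
   Context: An IOTS $A=(\mathit{states}_A,\mathit{start}_A,\mathit{act}_A,\to_A)$ has states, initial state, actions $\mathit{act}_A=\mathit{in}_A\cup\mathit{out}_A\cup\mathit{int}_A$ (disjoint: inputs, outputs, internal) and transitions $s\xrightarrow{a}_A s'$. $s\ (\xrightarrow{X})^*_A\ s'$ denotes a possibly empty sequence of transitions labelled in $X$; $\mathit{reach}(A)$ is the set of reachable states. Composable: $\mathit{act}_A\cap\mathit{act}_B=(\mathit{in}_A\cap\mathit{out}_B)\cup(\mathit{in}_B\cap\mathit{out}_A)=:\mathit{shared}(A,B)$. $A\otimes B$ (synchronous composition): states pairs, initial $(\mathit{start}_A,\mathit{start}_B)$, shared actions become internal and are executed jointly ($(s,t)\xrightarrow{a}(s',t')$ if $s\xrightarrow{a}_A s'$, $t\xrightarrow{a}_B t'$), non-shared actions of one component are executed by that component alone. Asynchronous composition: for $M$ a set of names, $M^\rhd=\{a^\rhd\mid a\in M\}$ fresh; $A,B$ asynchronously composable if composable and $\mathit{shared}(A,B)^\rhd\cap(\mathit{act}_A\cup\mathit{act}_B)=\emptyset$.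 With $\mathit{out}_{AB}=\mathit{out}_A\cap\mathit{in}_B$, $\Omega(A)$ is the IOTS with states $(s,q)$, $s\in\mathit{states}_A$, $q\in\mathit{out}_{AB}^*$, initial $(\mathit{start}_A,\epsilon)$, inputs $\mathit{in}_A$, outputs $\mathit{out}_A$, internal $\mathit{int}_A\cup\mathit{out}_{AB}^\rhd$, and transitions $(s,q)\xrightarrow{a}(s',q)$ if $s\xrightarrow{a}_A s'$ with $a\notin\mathit{out}_{AB}$; $(s,q)\xrightarrow{a^\rhd}(s',qa)$ if $s\xrightarrow{a}_A s'$ with $a\in\mathit{out}_{AB}$; $(s,aq)\xrightarrow{a}(s,q)$ for $a\in\mathit{out}_{AB}$ (this is $A$ with outputs to $B$ renamed to enqueue actions, synchronously composed with a FIFO queue). $\Omega(B)$ analogously with $\mathit{out}_{BA}=\mathit{out}_B\cap\mathit{in}_A$. $A\otimes_{as}B=\Omega(A)\otimes\Omega(B)$. It is half-duplex if every reachable state $((s_A,q_A),(s_B,q_B))$ has $q_A=\epsilon$ or $q_B=\epsilon$. $A,B$ are strongly synchronously compatible if composable and for all $(s_A,s_B)\in\mathit{reach}(A\otimes B)$ and $a\in\mathit{out}_A\cap\mathit{in}_B$, if $s_A\xrightarrow{a}_A s_A'$ then $s_B\xrightarrow{a}_B s_B'$ for some $s_B'$, and symmetrically. They are weakly synchronously compatible if instead $s_B\ (\xrightarrow{\mathit{int}_B})^*_B\ \bar s_B\xrightarrow{a}_B s_B'$ for some $\bar s_B,s_B'$, and symmetrically. An IOTS $A$ is I/O-separated if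 for every $s\in\mathit{reach}(A)$: if $s\xrightarrow{a}_A s'$ with $a\in\mathit{out}_A$, then there is no transition $s\xrightarrow{a'}_A s''$ with $a'\in\mathit{in}_A$. $A$ is observationally I/O-separated if for every $s\in\mathit{reach}(A)$: if $s\xrightarrow{a}_A s'$ with $a\in\mathit{out}_A$, then there is no sequence $s\ (\xrightarrow{\mathit{int}_A})^*_A\ \bar s\xrightarrow{a'}_A s''$ with $a'\in\mathit{in}_A$. -}

module Defs where

open import Data.Empty using (⊥)
open import Data.Product using (Σ; ∃; _×_; _,_)
open import Data.Sum using (_⊎_; inj₁; inj₂)
open import Data.List using (List; []; _∷_; _++_; [_])
open import Relation.Nullary using (¬_)
open import Relation.Binary.PropositionalEquality using (_≡_)
open import Relation.Binary.Construct.Closure.ReflexiveTransitive using (Star)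

record IOTS (Act : Set) : Set₁ where
  field
    State : Set
    start : State
    In    : Act → Set
    Out   : Act → Set
    Int   : Act → Set
    _⟶⟨_⟩_ : State → Act → State → Set

  act : Act → Set
  act a = In a ⊎ Out a ⊎ Int a

open IOTS public

record IsIOTS {Act : Set} (A : IOTS Act) : Set where
  field
    in-out  : ∀ a → In A a → Out A a → ⊥
    in-int  : ∀ a → In A a → Int A a → ⊥
    out-int : ∀ a → Out A a → Int A a → ⊥
    labels  : ∀ {s a s'} → _⟶⟨_⟩_ A s a s' → act A a

module _ {Act : Set} where

  Shared : IOTS Act → IOTS Act → Act → Set
  Shared A B a = (In A a × Out B a) ⊎ (In B a × Out A a)

  Composable : IOTS Act → IOTS Act → Set
  Composable A B =
    ∀ a → ((act A a × act B a) → Shared A B a) × (Shared A B a → (act A a × act B a))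

  data CompStep (A B : IOTS Act) : State A × State B → Act → State A × State B → Set where
    sync  : ∀ {s s' t t' a} → Shared A B a →
            _⟶⟨_⟩_ A s a s' → _⟶⟨_⟩_ B t a t' → CompStep A B (s , t) a (s' , t')
    left  : ∀ {s s' t a} → ¬ Shared A B a →
            _⟶⟨_⟩_ A s a s' → CompStep A B (s , t) a (s' , t)
    right : ∀ {s t t' a} → ¬ Shared A B a →
            _⟶⟨_⟩_ B t a t' → CompStep A B (s , t) a (s , t')

  _⊗_ : IOTS Act → IOTS Act → IOTS Act
  A ⊗ B = record
    { State  = State A × State B
    ; start  = start A , start B
    ; In     = λ a → (In A a ⊎ In B a) × ¬ Shared A B a
    ; Out    = λ a → (Out A a ⊎ Out B a) × ¬ Shared A B a
    ; Int    = λ a → Int A a ⊎ Int B a ⊎ Shared A B a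
    ; _⟶⟨_⟩_ = CompStep A B
    }

  data Reach (A : IOTS Act) : State A → Set where
    start-reach : Reach A (start A)
    step-reach  : ∀ {s a s'} → Reach A s → _⟶⟨_⟩_ A s a s' → Reach A s'

  IntSteps : (A : IOTS Act) → State A → State A → Set
  IntSteps A = Star (λ x y → ∃ λ a → Int A a × _⟶⟨_⟩_ A x a y)

  OutTo : IOTS Act → IOTS Act → Act → Set
  OutTo A B a = Out A a × In B a

-- Action universe of the asynchronous system: inj₁ a is the action a,
-- inj₂ a is the fresh enqueue action a^▷.
_▷ : {Act : Set} → Act → Act ⊎ Act
a ▷ = inj₂ a

module _ {Act : Set} where

  data ΩStep (A B : IOTS Act) : State A × List Act → Act ⊎ Act → State A × List Act → Set where
    local   : ∀ {s s' q a} → _⟶⟨_⟩_ A s a s' → ¬ OutTo A B a →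
              ΩStep A B (s , q) (inj₁ a) (s' , q)
    enqueue : ∀ {s s' q a} → _⟶⟨_⟩_ A s a s' → OutTo A B a →
              ΩStep A B (s , q) (a ▷) (s' , q ++ [ a ])
    dequeue : ∀ {s q a} → OutTo A B a →
              ΩStep A B (s , a ∷ q) (inj₁ a) (s , q)

  Ω : IOTS Act → IOTS Act → IOTS (Act ⊎ Act)
  Ω A B = record
    { State  = State A × List Act
    ; start  = start A , []
    ; In     = λ { (inj₁ a) → In A a ; (inj₂ _) → ⊥ }
    ; Out    = λ { (inj₁ a) → Out A a ; (inj₂ _) → ⊥ }
    ; Int    = λ { (inj₁ a) → Int A a ; (inj₂ a) → OutTo A B a }
    ; _⟶⟨_⟩_ = ΩStep A B
    }

  _⊗as_ : IOTS Act → IOTS Act → IOTS (Act ⊎ Act)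
  A ⊗as B = Ω A B ⊗ Ω B A

  -- Asynchronously composable: composable, and shared(A,B)^▷ disjoint from
  -- act_A ∪ act_B. The freshness condition holds by construction, since
  -- enqueue actions live in the separate summand (inj₂) of Act ⊎ Act.
  AsyncComposable : IOTS Act → IOTS Act → Set
  AsyncComposable A B = Composable A B

  HalfDuplex : (A B : IOTS Act) → Set
  HalfDuplex A B = ∀ {sA qA sB qB} → Reach (A ⊗as B) ((sA , qA) , (sB , qB)) →
                   (qA ≡ []) ⊎ (qB ≡ [])

  StronglySyncCompatible : IOTS Act → IOTS Act → Set
  StronglySyncCompatible A B = Composable A B ×
    (∀ {sA sB} → Reach (A ⊗ B) (sA , sB) →
      (∀ {a sA'} → Out A a → In B a → _⟶⟨_⟩_ A sA a sA' → ∃ λ sB' → _⟶⟨_⟩_ B sB a sB') ×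
      (∀ {a sB'} → Out B a → In A a → _⟶⟨_⟩_ B sB a sB' → ∃ λ sA' → _⟶⟨_⟩_ A sA a sA'))

  WeaklySyncCompatible : IOTS Act → IOTS Act → Set
  WeaklySyncCompatible A B = Composable A B ×
    (∀ {sA sB} → Reach (A ⊗ B) (sA , sB) →
      (∀ {a sA'} → Out A a → In B a → _⟶⟨_⟩_ A sA a sA' →
         ∃ λ s̄B → ∃ λ sB' → IntSteps B sB s̄B × _⟶⟨_⟩_ B s̄B a sB') ×
      (∀ {a sB'} → Out B a → In A a → _⟶⟨_⟩_ B sB a sB' →
         ∃ λ s̄A → ∃ λ sA' → IntSteps A sA s̄A × _⟶⟨_⟩_ A s̄A a sA'))

  IOSeparated : IOTS Act → Set
  IOSeparated A = ∀ {s a s' a' s''} → Reach A s → _⟶⟨_⟩_ A s a s' → Out A a →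
                  In A a' → ¬ (_⟶⟨_⟩_ A s a' s'')

  ObsIOSeparated : IOTS Act → Set
  ObsIOSeparated A = ∀ {s a s' s̄ a' s''} → Reach A s → _⟶⟨_⟩_ A s a s' → Out A a →
                     In A a' → ¬ (IntSteps A s s̄ × _⟶⟨_⟩_ A s̄ a' s'')

  NoMutualSends : IOTS Act → IOTS Act → Set
  NoMutualSends A B = ∀ {sA sB a b sA' sB'} → Reach (A ⊗ B) (sA , sB) →
    _⟶⟨_⟩_ A sA a sA' → _⟶⟨_⟩_ B sB b sB' →
    (¬ (Out A a × In B a)) ⊎ (¬ (Out B b × In A b))

-- If A can send a to B from a reachable state (sA, sB) of A ⊗ B, compatibility
-- lets B receive a from sB (possibly after internal steps), so by B's
-- (observational) I/O-separation no output of B is enabled at sB.  Hence A and B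
-- never both have a message for each other enabled.
--
-- For half-duplex: in every reachable asynchronous state where A's queue is
-- non-empty, B's queue is empty and the state arises from a reachable state
-- (s₀, sB) of A ⊗ B by letting A alone run ahead, sending exactly the queued
-- messages and otherwise taking only actions not shared with B.  Should B now
-- enqueue a message, then at the synchronous state just before A's first queued
-- send both A and B would have a message for the other enabled.
module Submission where

open import Defs
open import Data.Empty using (⊥; ⊥-elim)
open import Data.Product using (_×_; _,_; proj₁; proj₂)
open import Data.Sum using (_⊎_; inj₁; inj₂; swap)
open import Data.List using (List; []; _∷_; _++_; [_])
open import Function using (_∘_)
open import Relation.Nullary using (¬_; Dec; yes; no)
open import Relation.Binary.PropositionalEquality using (refl)

module _ {Act : Set} where

  label-out? : {A : IOTS Act} → IsIOTS A → ∀ {s a s'} → _⟶⟨_⟩_ A s a s' → Dec (Out A a)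
  label-out? wf {a = a} step with IsIOTS.labels wf step
  ... | inj₁ i        = no (IsIOTS.in-out wf a i)
  ... | inj₂ (inj₁ o) = yes o
  ... | inj₂ (inj₂ n) = no (λ o → IsIOTS.out-int wf a o n)

  ⊗-swap-step : ∀ {A B : IOTS Act} {s t l s' t'} →
                CompStep A B (s , t) l (s' , t') → CompStep B A (t , s) l (t' , s')
  ⊗-swap-step (sync sh stA stB) = sync (swap sh) stB stA
  ⊗-swap-step (left ¬sh st)     = right (¬sh ∘ swap) st
  ⊗-swap-step (right ¬sh st)    = left (¬sh ∘ swap) st

  ⊗-reach-swap : ∀ {A B : IOTS Act} {s t} → Reach (A ⊗ B) (s , t) → Reach (B ⊗ A) (t , s)
  ⊗-reach-swap start-reach                   = start-reach
  ⊗-reach-swap (step-reach {s = _ , _} r st) = step-reach (⊗-reach-swap r) (⊗-swap-step st)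

  ⊗-reach-proj₂ : ∀ {A B : IOTS Act} {s t} → Reach (A ⊗ B) (s , t) → Reach B t
  ⊗-reach-proj₂ start-reach                              = start-reach
  ⊗-reach-proj₂ (step-reach {s = _ , _} r (sync _ _ st)) = step-reach (⊗-reach-proj₂ r) st
  ⊗-reach-proj₂ (step-reach {s = _ , _} r (left _ _))    = ⊗-reach-proj₂ r
  ⊗-reach-proj₂ (step-reach {s = _ , _} r (right _ st))  = step-reach (⊗-reach-proj₂ r) st

module _ {Act : Set} where

  NoMutualSends-swap : ∀ {A B : IOTS Act} → NoMutualSends A B → NoMutualSends B A
  NoMutualSends-swap nms r stB stA = swap (nms (⊗-reach-swap r) stA stB)

  no-mutual-send : ∀ {A B : IOTS Act} → NoMutualSends A B →
                   ∀ {s t a b s' t'} → Reach (A ⊗ B) (s , t) →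
                   _⟶⟨_⟩_ A s a s' → _⟶⟨_⟩_ B t b t' → OutTo A B a → OutTo B A b → ⊥
  no-mutual-send nms r stA stB oa ob with nms r stA stB
  ... | inj₁ ¬oa = ¬oa oa
  ... | inj₂ ¬ob = ¬ob ob

  ReceiverCannotOutput : IOTS Act → IOTS Act → Set
  ReceiverCannotOutput A B = ∀ {sA sB a b sA' sB'} → Reach (A ⊗ B) (sA , sB) →
    _⟶⟨_⟩_ A sA a sA' → OutTo A B a → _⟶⟨_⟩_ B sB b sB' → ¬ Out B b

  io-separated⇒receiver-cannot-output : ∀ {A B : IOTS Act} →
    IOSeparated B → StronglySyncCompatible A B → ReceiverCannotOutput A B
  io-separated⇒receiver-cannot-output sepB (_ , compat) r stA (oA , iB) stB oB =
    sepB (⊗-reach-proj₂ r) stB oB iB (proj₂ (proj₁ (compat r) oA iB stA))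

  obs-io-separated⇒receiver-cannot-output : ∀ {A B : IOTS Act} →
    ObsIOSeparated B → WeaklySyncCompatible A B → ReceiverCannotOutput A B
  obs-io-separated⇒receiver-cannot-output sepB (_ , compat) r stA (oA , iB) stB oB
    with proj₁ (compat r) oA iB stA
  ... | _ , _ , internal , receive = sepB (⊗-reach-proj₂ r) stB oB iB (internal , receive)

  -- Constructively the disjunct must be chosen: decide whether b is an output.
  receiver-cannot-output⇒no-mutual-sends : ∀ {A B : IOTS Act} →
    IsIOTS B → ReceiverCannotOutput A B → NoMutualSends A B
  receiver-cannot-output⇒no-mutual-sends wfB rco r stA stB with label-out? wfB stB
  ... | yes oB = inj₁ (λ oA → rco r stA oA stB oB)
  ... | no ¬oB = inj₂ (¬oB ∘ proj₁)

  data SendRun (A B : IOTS Act) : State A → List Act → State A → Set where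
    done  : ∀ {s} → SendRun A B s [] s
    send  : ∀ {s s' q t a} → _⟶⟨_⟩_ A s a s' → OutTo A B a →
            SendRun A B s' q t → SendRun A B s (a ∷ q) t
    quiet : ∀ {s s' q t a} → _⟶⟨_⟩_ A s a s' → ¬ Shared A B a →
            SendRun A B s' q t → SendRun A B s q t

  extend-send : ∀ {A B : IOTS Act} {s q t a t'} → SendRun A B s q t →
                _⟶⟨_⟩_ A t a t' → OutTo A B a → SendRun A B s (q ++ [ a ]) t'
  extend-send done          st o = send st o done
  extend-send (send x o' p) st o = send x o' (extend-send p st o)
  extend-send (quiet x n p) st o = quiet x n (extend-send p st o)

  extend-quiet : ∀ {A B : IOTS Act} {s q t a t'} → SendRun A B s q t →
                 _⟶⟨_⟩_ A t a t' → ¬ Shared A B a → SendRun A B s q t'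
  extend-quiet done           st n = quiet st n done
  extend-quiet (send x o p)   st n = send x o (extend-quiet p st n)
  extend-quiet (quiet x n' p) st n = quiet x n' (extend-quiet p st n)

  quiet-run-reach : ∀ {A B : IOTS Act} {s t u} →
                    Reach (A ⊗ B) (s , u) → SendRun A B s [] t → Reach (A ⊗ B) (t , u)
  quiet-run-reach r done          = r
  quiet-run-reach r (quiet x n p) = quiet-run-reach (step-reach r (left n x)) p

  data FirstSend (A B : IOTS Act) (u : State B) (a : Act) (q : List Act) (t : State A) : Set where
    first-send : ∀ {s s'} → Reach (A ⊗ B) (s , u) → _⟶⟨_⟩_ A s a s' → OutTo A B a →
                 SendRun A B s' q t → FirstSend A B u a q t

  first-send-reach : ∀ {A B : IOTS Act} {s u a q t} →
                     Reach (A ⊗ B) (s , u) → SendRun A B s (a ∷ q) t → FirstSend A B u a q t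
  first-send-reach r (send x o p)  = first-send r x o p
  first-send-reach r (quiet x n p) = first-send-reach (step-reach r (left n x)) p

  data Pending (A B : IOTS Act) : State A × List Act → State B → Set where
    pending : ∀ {s₀ sA sB a q} → Reach (A ⊗ B) (s₀ , sB) → SendRun A B s₀ (a ∷ q) sA →
              Pending A B (sA , a ∷ q) sB

  data AsyncInv (A B : IOTS Act) : State A × List Act → State B × List Act → Set where
    in-sync : ∀ {sA sB} → Reach (A ⊗ B) (sA , sB) → AsyncInv A B (sA , []) (sB , [])
    A-ahead : ∀ {x sB} → Pending A B x sB → AsyncInv A B x (sB , [])
    B-ahead : ∀ {sA y} → Pending B A y sA → AsyncInv A B (sA , []) y

  AsyncInv-swap : ∀ {A B : IOTS Act} {x y} → AsyncInv A B x y → AsyncInv B A y x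
  AsyncInv-swap (in-sync r) = in-sync (⊗-reach-swap r)
  AsyncInv-swap (A-ahead p) = B-ahead p
  AsyncInv-swap (B-ahead p) = A-ahead p

  resume : ∀ {A B : IOTS Act} {s q t u} →
           Reach (A ⊗ B) (s , u) → SendRun A B s q t → AsyncInv A B (t , q) (u , [])
  resume {q = []}    r p = in-sync (quiet-run-reach r p)
  resume {q = _ ∷ _} r p = A-ahead (pending r p)

  locals-not-shared : ∀ {A B : IOTS Act} {a} → ¬ OutTo A B a → ¬ OutTo B A a → ¬ Shared A B a
  locals-not-shared ¬oA ¬oB (inj₁ (i , o)) = ¬oB (o , i)
  locals-not-shared ¬oA ¬oB (inj₂ (i , o)) = ¬oA (o , i)

  in-sync-step : ∀ {A B : IOTS Act} {sA sB l x' y'} → Reach (A ⊗ B) (sA , sB) →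
                 CompStep (Ω A B) (Ω B A) ((sA , []) , (sB , [])) l (x' , y') → AsyncInv A B x' y'
  in-sync-step {A} {B} r (sync sh (local _ ¬oA) (local _ ¬oB)) =
    ⊥-elim (locals-not-shared {A = A} {B} ¬oA ¬oB sh)
  in-sync-step r (sync (inj₁ (() , _)) (enqueue _ _) _)
  in-sync-step r (sync (inj₂ (() , _)) (enqueue _ _) _)
  in-sync-step r (left ¬sh (local st _))   = in-sync (step-reach r (left ¬sh st))
  in-sync-step r (left ¬sh (enqueue st o)) = resume r (send st o done)
  in-sync-step r (right ¬sh (local st _))  = in-sync (step-reach r (right ¬sh st))
  in-sync-step r (right ¬sh (enqueue st o)) =
    AsyncInv-swap (resume (⊗-reach-swap r) (send st o done))

  pending-step : ∀ {A B : IOTS Act} {x sB l x' y'} → NoMutualSends A B → Pending A B x sB →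
                 CompStep (Ω A B) (Ω B A) (x , (sB , [])) l (x' , y') → AsyncInv A B x' y'
  pending-step {A} {B} _ _ (sync sh (local _ ¬oA) (local _ ¬oB)) =
    ⊥-elim (locals-not-shared {A = A} {B} ¬oA ¬oB sh)
  pending-step _ _ (sync (inj₁ (() , _)) (enqueue _ _) _)
  pending-step _ _ (sync (inj₂ (() , _)) (enqueue _ _) _)
  pending-step _ (pending r p) (sync sh (dequeue _) (local stB _))
    with first-send-reach r p
  ... | first-send r₁ stA _ rest = resume (step-reach r₁ (sync sh stA stB)) rest
  pending-step _ (pending r p) (left ¬sh (local st _))   = A-ahead (pending r (extend-quiet p st ¬sh))
  pending-step _ (pending r p) (left ¬sh (enqueue st o)) = A-ahead (pending r (extend-send p st o))
  pending-step _ _ (left ¬sh (dequeue (o , i))) = ⊥-elim (¬sh (inj₂ (i , o)))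
  pending-step _ (pending r p) (right ¬sh (local st _))  =
    A-ahead (pending (step-reach r (right ¬sh st)) p)
  pending-step nms (pending r p) (right ¬sh (enqueue stB oB))
    with first-send-reach r p
  ... | first-send r₁ stA oA _ = ⊥-elim (no-mutual-send nms r₁ stA stB oA oB)

  async-step : ∀ {A B : IOTS Act} {x y l x' y'} → NoMutualSends A B → AsyncInv A B x y →
               CompStep (Ω A B) (Ω B A) (x , y) l (x' , y') → AsyncInv A B x' y'
  async-step _   (in-sync r) st = in-sync-step r st
  async-step nms (A-ahead p) st = pending-step nms p st
  async-step {A} {B} nms (B-ahead p) st =
    AsyncInv-swap (pending-step (NoMutualSends-swap nms) p (⊗-swap-step {A = Ω A B} {Ω B A} st))

  async-reach-inv : ∀ {A B : IOTS Act} {x y} → NoMutualSends A B →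
                    Reach (A ⊗as B) (x , y) → AsyncInv A B x y
  async-reach-inv nms start-reach                   = in-sync start-reach
  async-reach-inv nms (step-reach {s = _ , _} r st) = async-step nms (async-reach-inv nms r) st

  no-mutual-sends⇒half-duplex : ∀ {A B : IOTS Act} → NoMutualSends A B → HalfDuplex A B
  no-mutual-sends⇒half-duplex nms r with async-reach-inv nms r
  ... | in-sync _ = inj₁ refl
  ... | A-ahead (pending _ _) = inj₂ refl
  ... | B-ahead (pending _ _) = inj₁ refl

lemma4p5 : {Act : Set} (A B : IOTS Act) → IsIOTS A → IsIOTS B → AsyncComposable A B →
    ((IOSeparated A × IOSeparated B × StronglySyncCompatible A B) →
      HalfDuplex A B × NoMutualSends A B)
    × ((ObsIOSeparated A × ObsIOSeparated B × WeaklySyncCompatible A B) →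
      HalfDuplex A B × NoMutualSends A B)
lemma4p5 A B _ wfB _ =
    (λ (_ , sepB , compat) → conclude (io-separated⇒receiver-cannot-output sepB compat))
  , (λ (_ , sepB , compat) → conclude (obs-io-separated⇒receiver-cannot-output sepB compat))
  where
  conclude : ReceiverCannotOutput A B → HalfDuplex A B × NoMutualSends A B
  conclude rco = no-mutual-sends⇒half-duplex nms , nms
    where
    nms : NoMutualSends A B
    nms = receiver-cannot-output⇒no-mutual-sends wfB rco
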